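{- Fix any odd positive integer $q$. For every $n$ there exist integers $c_1,\dots,c_q\in\mathbb{Z}$ and a distribution $\mathcal{D}$ over $(\{0,1\}^n)^q$ such that for every sample $(y^{(1)},\dots,y^{(q)})$ in the support of $\mathcal{D}$: (1) $c_1+\dots+c_q=1$ and $c_1y^{(1)}_i+\dots+c_qy^{(q)}_i=1$ for all $i\in[n]$; (2) for each $j\in[q]$, the distribution of $y^{(j)}$ is $\sqrt{n}\cdot 2^{ -\Omega(q)}$-close in statistical distance to the uniform distribution on $\{0,1\}^n$.
   Context: Statistical distance between distributions $X,Y$ on $\{0,1\}^n$: $\max_{T\subseteq\{0,1\}^n}|\Pr[X\in T]-\Pr[Y\in T]|$; $X,Y$ are $\varepsilon$-close if this is at most $\varepsilon$. The $\Omega(\cdot)$ hides an absolute constant. -}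

module Defs where

open import Data.Bool using (Bool; true; false; if_then_else_)
open import Data.Nat as ℕ using (ℕ; zero; suc)
open import Data.Integer as ℤ using (ℤ)
open import Data.Rational as ℚ using (ℚ; 0ℚ; 1ℚ; _+_; _*_; _≤_; ∣_∣; _-_; _/_)
open import Data.Fin using (Fin)
open import Data.List as List using (List; []; _∷_; concatMap; map)
open import Data.Vec as Vec using (Vec; []; _∷_; lookup)
open import Relation.Binary.PropositionalEquality using (_≡_)
open import Relation.Nullary using (¬_)

Point : ℕ → Set
Point n = Vec Bool n

allVecs : {A : Set} → List A → (n : ℕ) → List (Vec A n)
allVecs xs zero = [] ∷ []
allVecs xs (suc n) = concatMap (λ x → map (x ∷_) (allVecs xs n)) xs

allPoints : (n : ℕ) → List (Point n)
allPoints n = allVecs (false ∷ true ∷ []) n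

allSamples : (n q : ℕ) → List (Vec (Point n) q)
allSamples n q = allVecs (allPoints n) q

Σ[_]_ : {A : Set} → List A → (A → ℚ) → ℚ
Σ[ xs ] f = List.foldr _+_ 0ℚ (map f xs)

infixr 8 _^ℚ_
_^ℚ_ : ℚ → ℕ → ℚ
p ^ℚ zero = 1ℚ
p ^ℚ suc k = p * (p ^ℚ k)

𝟙 : Bool → ℚ
𝟙 true = 1ℚ
𝟙 false = 0ℚ

record Distribution (n q : ℕ) : Set where
  field
    pr     : Vec (Point n) q → ℚ
    nonneg : ∀ s → 0ℚ ≤ pr s
    total  : Σ[ allSamples n q ] pr ≡ 1ℚ

open Distribution public

InSupport : {n q : ℕ} → Distribution n q → Vec (Point n) q → Set
InSupport D s = ¬ (pr D s ≡ 0ℚ)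

Subset : ℕ → Set
Subset n = Point n → Bool

PrMarginal : {n q : ℕ} → Distribution n q → Fin q → Subset n → ℚ
PrMarginal {n} {q} D j T = Σ[ allSamples n q ] (λ s → pr D s * 𝟙 (T (lookup s j)))

PrUniform : (n : ℕ) → Subset n → ℚ
PrUniform n T = Σ[ allPoints n ] (λ x → 𝟙 (T x) * ((ℤ.+ 1 / 2) ^ℚ n))

-- The marginal y^(j) of D is ε-close to uniform, where ε = √n · 2^{-q/k}.
-- Since ε is irrational in general, "|Pr[y^(j)∈T] - Pr[U∈T]| ≤ √n · 2^{-q/k}"
-- is written in the equivalent form (both sides nonnegative)
-- |Pr[y^(j)∈T] - Pr[U∈T]|^(2k) ≤ n^k · 2^{-2q}.
MarginalClose : {n q : ℕ} → (k : ℕ) → Distribution n q → Fin q → Set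
MarginalClose {n} {q} k D j =
  ∀ (T : Subset n) →
    ∣ PrMarginal D j T - PrUniform n T ∣ ^ℚ (2 ℕ.* k)
      ≤ ((ℤ.+ n / 1) ^ℚ k) * ((ℤ.+ 1 / 4) ^ℚ q)

bitℤ : Bool → ℤ
bitℤ true = ℤ.+ 1
bitℤ false = ℤ.+ 0

sumℤ : {q : ℕ} → Vec ℤ q → ℤ
sumℤ = Vec.foldr _ ℤ._+_ (ℤ.+ 0)

lincomb : {n q : ℕ} → Vec ℤ q → Vec (Point n) q → Fin n → ℤ
lincomb c ys i = sumℤ (Vec.zipWith (λ cj y → cj ℤ.* bitℤ (lookup y i)) c ys)

module Submission where

-- Every coordinate i gets its own column (y⁽¹⁾ᵢ, …, y⁽ᵠ⁾ᵢ), drawn independently from one law on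
-- {0,1}^q supported on solutions of c·x = 1. For q = 2m+1 that law is the image of m+1 uniform seed
-- bits under a carry chain: the first seed bit e yields the output ¬e (weight 1) and the carry g = e
-- (weight 1); each further seed bit a yields the pair (a, a ⊕ g) with weights (−w, w) and passes on
-- the carry a ∧ g with weight 2w, because (a ⊕ g) − a = g − 2(a ∧ g); a last pair (a ∧ ¬g, a ∨ g)
-- absorbs the final carry. So c·x = ¬e + e = 1. Each output bit is exactly uniform once the carry
-- is 0, and each fresh seed bit halves the probability that it is still 1, so every output bit has
-- bias at most 2^-(m+1). A hybrid argument over the n coordinates turns bias δ into distance at most
-- nδ from uniform; as this distance d is also at most 1, d⁸ ≤ d⁴ ≤ n⁴ 2^-(4m+4) ≤ n⁴ 4^-q, which is
-- the closeness √n · 2^-(q/4) with k = 4.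

open import Data.Bool as Bool using (Bool; true; false; not; _∧_; _∨_; _xor_)
open import Data.Empty using (⊥-elim)
open import Data.Fin using (Fin; zero; suc)
open import Data.Integer as ℤ using (ℤ; +_)
import Data.Integer.Properties as ℤ
import Data.Integer.Solver as ℤ-Solver
open import Data.List as List using (List; []; _∷_; _++_; concatMap)
open import Data.Nat as ℕ using (ℕ; zero; suc; _≥_; _*_; s≤s; z≤n)
import Data.Nat.Properties as ℕ
open import Data.Product using (Σ; ∃; _×_; _,_; proj₁; proj₂)
-- ℚ multiplication is written _·_, leaving _*_ to ℕ as in the statement.
open import Data.Rational using (ℚ; 0ℚ; 1ℚ; _+_; _-_; -_; _≤_; ∣_∣; _/_; _≤?_; toℚᵘ; nonNegative)
  renaming (_*_ to _·_)
open import Data.Rational.Properties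
open import Data.Rational.Unnormalised.Base using (mkℚᵘ; *≡*)
import Data.Rational.Unnormalised.Base as ℚᵘ
import Data.Rational.Unnormalised.Properties as ℚᵘ
open import Data.Rational.Solver using (module +-*-Solver)
open import Data.Sum using (inj₁; inj₂)
open import Data.Vec as Vec using (Vec; []; _∷_; lookup; zipWith)
open import Data.Vec.Properties using (≡-dec; lookup-zipWith; zipWith-map₂)
open import Relation.Binary.Definitions using (DecidableEquality)
open import Relation.Binary.PropositionalEquality
open import Relation.Nullary using (¬_; does; yes; no)
open import Relation.Nullary.Decidable using (from-yes)

open import Defs

open +-*-Solver
module ZS = ℤ-Solver.+-*-Solver

½ : ℚ
½ = + 1 / 2

¼ : ℚ
¼ = + 1 / 4

IsProb : ℚ → Set
IsProb x = 0ℚ ≤ x × x ≤ 1ℚ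

0≤1 : 0ℚ ≤ 1ℚ
0≤1 = from-yes (0ℚ ≤? 1ℚ)

0≤½ : 0ℚ ≤ ½
0≤½ = from-yes (0ℚ ≤? ½)

*-nonNeg : {p q : ℚ} → 0ℚ ≤ p → 0ℚ ≤ q → 0ℚ ≤ p · q
*-nonNeg {p} {q} 0≤p 0≤q =
  nonNegative⁻¹ _ {{nonNeg*nonNeg⇒nonNeg p {{nonNegative 0≤p}} q {{nonNegative 0≤q}}}}

*-mono-≤-nonNeg : {p q r s : ℚ} → 0ℚ ≤ p → p ≤ q → 0ℚ ≤ r → r ≤ s → p · r ≤ q · s
*-mono-≤-nonNeg {p} {q} {r} {s} 0≤p p≤q 0≤r r≤s =
  ≤-trans (*-monoˡ-≤-nonNeg p {{nonNegative 0≤p}} r≤s)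
          (*-monoʳ-≤-nonNeg s {{nonNegative (≤-trans 0≤r r≤s)}} p≤q)

∣c*p∣≤c*q : {c p q : ℚ} → 0ℚ ≤ c → ∣ p ∣ ≤ q → ∣ c · p ∣ ≤ c · q
∣c*p∣≤c*q {c} {p} {q} 0≤c ∣p∣≤q = begin
  ∣ c · p ∣      ≡⟨ ∣p*q∣≡∣p∣*∣q∣ c p ⟩
  ∣ c ∣ · ∣ p ∣  ≡⟨ cong (_· ∣ p ∣) (0≤p⇒∣p∣≡p 0≤c) ⟩
  c · ∣ p ∣      ≤⟨ *-monoˡ-≤-nonNeg c {{nonNegative 0≤c}} ∣p∣≤q ⟩
  c · q          ∎
  where open ≤-Reasoning

0≤1-p : {p : ℚ} → p ≤ 1ℚ → 0ℚ ≤ 1ℚ - p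
0≤1-p {p} p≤1 = subst (_≤ 1ℚ - p) (+-inverseʳ p) (+-monoˡ-≤ (- p) p≤1)

p-q≤p : {p q : ℚ} → 0ℚ ≤ q → p - q ≤ p
p-q≤p {p} 0≤q = subst (p - _ ≤_) (+-identityʳ p) (+-monoʳ-≤ p (neg-antimono-≤ 0≤q))

∣p-q∣≤1 : {p q : ℚ} → IsProb p → IsProb q → ∣ p - q ∣ ≤ 1ℚ
∣p-q∣≤1 {p} {q} (0≤p , p≤1) (0≤q , q≤1) with ∣p∣≡p∨∣p∣≡-p (p - q)
... | inj₁ ∣p-q∣≡p-q = begin
  ∣ p - q ∣  ≡⟨ ∣p-q∣≡p-q ⟩
  p - q      ≤⟨ p-q≤p 0≤q ⟩
  p          ≤⟨ p≤1 ⟩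
  1ℚ         ∎
  where open ≤-Reasoning
... | inj₂ ∣p-q∣≡q-p = begin
  ∣ p - q ∣  ≡⟨ ∣p-q∣≡q-p ⟩
  - (p - q)  ≡⟨ solve 2 (λ p q → :- (p :- q) := q :- p) refl p q ⟩
  q - p      ≤⟨ p-q≤p 0≤p ⟩
  q          ≤⟨ q≤1 ⟩
  1ℚ         ∎
  where open ≤-Reasoning

*≢0⇒≢0 : {p q : ℚ} → ¬ (p · q ≡ 0ℚ) → ¬ (p ≡ 0ℚ) × ¬ (q ≡ 0ℚ)
*≢0⇒≢0 {p} {q} pq≢0 =
  (λ p≡0 → pq≢0 (trans (cong (_· q) p≡0) (*-zeroˡ q))) ,
  (λ q≡0 → pq≢0 (trans (cong (p ·_) q≡0) (*-zeroʳ p)))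

𝟙-prob : (b : Bool) → IsProb (𝟙 b)
𝟙-prob false = ≤-refl , 0≤1
𝟙-prob true  = 0≤1 , ≤-refl

𝟙-∧ : (a b : Bool) → 𝟙 (a ∧ b) ≡ 𝟙 a · 𝟙 b
𝟙-∧ false b = sym (*-zeroˡ (𝟙 b))
𝟙-∧ true  b = sym (*-identityˡ (𝟙 b))

^-distribʳ-* : (x y : ℚ) (k : ℕ) → (x · y) ^ℚ k ≡ x ^ℚ k · y ^ℚ k
^-distribʳ-* x y zero    = refl
^-distribʳ-* x y (suc k) = begin
  x · y · (x · y) ^ℚ k        ≡⟨ cong (x · y ·_) (^-distribʳ-* x y k) ⟩
  x · y · (x ^ℚ k · y ^ℚ k)   ≡⟨ solve 4 (λ x y u v → x :* y :* (u :* v) := x :* u :* (y :* v))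
                                    refl x y (x ^ℚ k) (y ^ℚ k) ⟩
  x · x ^ℚ k · (y · y ^ℚ k)   ∎
  where open ≡-Reasoning

^-+ : (x : ℚ) (m n : ℕ) → x ^ℚ (m ℕ.+ n) ≡ x ^ℚ m · x ^ℚ n
^-+ x zero    n = sym (*-identityˡ (x ^ℚ n))
^-+ x (suc m) n = trans (cong (x ·_) (^-+ x m n)) (sym (*-assoc x (x ^ℚ m) (x ^ℚ n)))

^-nonNeg : {x : ℚ} (k : ℕ) → 0ℚ ≤ x → 0ℚ ≤ x ^ℚ k
^-nonNeg zero    0≤x = 0≤1
^-nonNeg (suc k) 0≤x = *-nonNeg 0≤x (^-nonNeg k 0≤x)

^-mono-≤ : {x y : ℚ} (k : ℕ) → 0ℚ ≤ x → x ≤ y → x ^ℚ k ≤ y ^ℚ k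
^-mono-≤ zero    0≤x x≤y = ≤-refl
^-mono-≤ (suc k) 0≤x x≤y = *-mono-≤-nonNeg 0≤x x≤y (^-nonNeg k 0≤x) (^-mono-≤ k 0≤x x≤y)

^-prob : {x : ℚ} (k : ℕ) → IsProb x → IsProb (x ^ℚ k)
^-prob zero    _              = 0≤1 , ≤-refl
^-prob (suc k) (0≤x , x≤1) with ^-prob k (0≤x , x≤1)
... | 0≤xᵏ , xᵏ≤1 = *-nonNeg 0≤x 0≤xᵏ , *-mono-≤-nonNeg 0≤x x≤1 0≤xᵏ xᵏ≤1

prob-^-squeeze : {x z : ℚ} (k : ℕ) → IsProb x → x ≤ z → x ^ℚ (2 * k) ≤ z ^ℚ k
prob-^-squeeze {x} {z} k x-prob x≤z = begin
  x ^ℚ (k ℕ.+ (k ℕ.+ 0))   ≡⟨ trans (^-+ x k (k ℕ.+ 0)) (cong (λ i → xᵏ · x ^ℚ i) (ℕ.+-identityʳ k)) ⟩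
  xᵏ · xᵏ                   ≤⟨ *-monoˡ-≤-nonNeg xᵏ {{nonNegative 0≤xᵏ}} xᵏ≤1 ⟩
  xᵏ · 1ℚ                   ≡⟨ *-identityʳ xᵏ ⟩
  xᵏ                       ≤⟨ ^-mono-≤ k (proj₁ x-prob) x≤z ⟩
  z ^ℚ k                   ∎
  where
  open ≤-Reasoning
  xᵏ = x ^ℚ k
  0≤xᵏ = proj₁ (^-prob k x-prob)
  xᵏ≤1 = proj₂ (^-prob k x-prob)

0≤n/1 : (n : ℕ) → 0ℚ ≤ + n / 1
0≤n/1 n = nonNegative⁻¹ (+ n / 1) {{normalize-nonNeg n 1}}

+[1+n]/1≡1+n/1 : (n : ℕ) → + suc n / 1 ≡ 1ℚ + + n / 1
+[1+n]/1≡1+n/1 n = toℚᵘ-injective (begin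
  toℚᵘ (+ suc n / 1)          ≈⟨ toℚᵘ-fromℚᵘ (mkℚᵘ (+ suc n) 0) ⟩
  mkℚᵘ (+ suc n) 0            ≈⟨ *≡* (cong (ℤ._* + 1) (cong (ℤ._+_ (+ 1)) (sym (ℤ.*-identityʳ (+ n))))) ⟩
  ℚᵘ.1ℚᵘ ℚᵘ.+ mkℚᵘ (+ n) 0    ≈⟨ ℚᵘ.+-congʳ ℚᵘ.1ℚᵘ (toℚᵘ-fromℚᵘ (mkℚᵘ (+ n) 0)) ⟨
  ℚᵘ.1ℚᵘ ℚᵘ.+ toℚᵘ (+ n / 1)  ≈⟨ toℚᵘ-homo-+ 1ℚ (+ n / 1) ⟨
  toℚᵘ (1ℚ + + n / 1)         ∎)
  where open ℚᵘ.≃-Reasoning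

-- Finite sums

Σ-cong : {A : Set} (xs : List A) {f g : A → ℚ} → (∀ x → f x ≡ g x) → Σ[ xs ] f ≡ Σ[ xs ] g
Σ-cong []       f≡g = refl
Σ-cong (x ∷ xs) f≡g = cong₂ _+_ (f≡g x) (Σ-cong xs f≡g)

Σ-++ : {A : Set} (xs ys : List A) (f : A → ℚ) → Σ[ xs ++ ys ] f ≡ Σ[ xs ] f + Σ[ ys ] f
Σ-++ []       ys f = sym (+-identityˡ _)
Σ-++ (x ∷ xs) ys f = trans (cong (_+_ (f x)) (Σ-++ xs ys f)) (sym (+-assoc (f x) _ _))

Σ-map : {A B : Set} (g : A → B) (xs : List A) (f : B → ℚ) → Σ[ List.map g xs ] f ≡ Σ[ xs ] (λ x → f (g x))
Σ-map g []       f = refl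
Σ-map g (x ∷ xs) f = cong (_+_ (f (g x))) (Σ-map g xs f)

Σ-concatMap : {A B : Set} (g : A → List B) (xs : List A) (f : B → ℚ) →
              Σ[ concatMap g xs ] f ≡ Σ[ xs ] (λ x → Σ[ g x ] f)
Σ-concatMap g []       f = refl
Σ-concatMap g (x ∷ xs) f = trans (Σ-++ (g x) _ f) (cong (_+_ (Σ[ g x ] f)) (Σ-concatMap g xs f))

Σ-allVecs : {A : Set} (xs : List A) (k : ℕ) (f : Vec A (suc k) → ℚ) →
            Σ[ allVecs xs (suc k) ] f ≡ Σ[ xs ] (λ x → Σ[ allVecs xs k ] (λ v → f (x ∷ v)))
Σ-allVecs xs k f = trans (Σ-concatMap _ xs f) (Σ-cong xs (λ x → Σ-map (x ∷_) (allVecs xs k) f))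

Σ-distrib-+ : {A : Set} (xs : List A) (f g : A → ℚ) → Σ[ xs ] (λ x → f x + g x) ≡ Σ[ xs ] f + Σ[ xs ] g
Σ-distrib-+ []       f g = refl
Σ-distrib-+ (x ∷ xs) f g = trans (cong (_+_ (f x + g x)) (Σ-distrib-+ xs f g))
  (solve 4 (λ a b c d → (a :+ b) :+ (c :+ d) := (a :+ c) :+ (b :+ d)) refl (f x) (g x) (Σ[ xs ] f) (Σ[ xs ] g))

Σ-*ˡ : {A : Set} (xs : List A) (a : ℚ) (f : A → ℚ) → Σ[ xs ] (λ x → a · f x) ≡ a · Σ[ xs ] f
Σ-*ˡ []       a f = sym (*-zeroʳ a)
Σ-*ˡ (x ∷ xs) a f = trans (cong (_+_ (a · f x)) (Σ-*ˡ xs a f)) (sym (*-distribˡ-+ a (f x) _))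

Σ-*ʳ : {A : Set} (xs : List A) (a : ℚ) (f : A → ℚ) → Σ[ xs ] (λ x → f x · a) ≡ Σ[ xs ] f · a
Σ-*ʳ xs a f = trans (Σ-cong xs (λ x → *-comm (f x) a)) (trans (Σ-*ˡ xs a f) (*-comm a _))

Σ-zero : {A : Set} (xs : List A) → Σ[ xs ] (λ _ → 0ℚ) ≡ 0ℚ
Σ-zero []       = refl
Σ-zero (x ∷ xs) = trans (+-identityˡ _) (Σ-zero xs)

Σ-comm : {A B : Set} (xs : List A) (ys : List B) (f : A → B → ℚ) →
         Σ[ xs ] (λ x → Σ[ ys ] (f x)) ≡ Σ[ ys ] (λ y → Σ[ xs ] (λ x → f x y))
Σ-comm []       ys f = sym (Σ-zero ys)
Σ-comm (x ∷ xs) ys f = trans (cong (_+_ (Σ[ ys ] (f x))) (Σ-comm xs ys f)) (sym (Σ-distrib-+ ys (f x) _))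

Σ-mono-≤ : {A : Set} (xs : List A) {f g : A → ℚ} → (∀ x → f x ≤ g x) → Σ[ xs ] f ≤ Σ[ xs ] g
Σ-mono-≤ []       f≤g = ≤-refl
Σ-mono-≤ (x ∷ xs) f≤g = +-mono-≤ (f≤g x) (Σ-mono-≤ xs f≤g)

Σ-nonNeg : {A : Set} (xs : List A) {f : A → ℚ} → (∀ x → 0ℚ ≤ f x) → 0ℚ ≤ Σ[ xs ] f
Σ-nonNeg []       0≤f = ≤-refl
Σ-nonNeg (x ∷ xs) 0≤f = +-mono-≤ (0≤f x) (Σ-nonNeg xs 0≤f)

Σ-≢0⇒∃ : {A : Set} (xs : List A) {f : A → ℚ} → ¬ (Σ[ xs ] f ≡ 0ℚ) → ∃ λ x → ¬ (f x ≡ 0ℚ)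
Σ-≢0⇒∃ []           Σ≢0 = ⊥-elim (Σ≢0 refl)
Σ-≢0⇒∃ (x ∷ xs) {f} Σ≢0 with f x ≟ 0ℚ
... | no  fx≢0 = x , fx≢0
... | yes fx≡0 = Σ-≢0⇒∃ xs (λ Σxs≡0 → Σ≢0 (cong₂ _+_ fx≡0 Σxs≡0))

Σ-𝟙-prob : {A : Set} (xs : List A) {w : A → ℚ} → (∀ x → 0ℚ ≤ w x) → Σ[ xs ] w ≡ 1ℚ →
           (φ : A → Bool) → IsProb (Σ[ xs ] (λ x → w x · 𝟙 (φ x)))
Σ-𝟙-prob xs {w} 0≤w Σw≡1 φ =
  Σ-nonNeg xs (λ x → *-nonNeg (0≤w x) (proj₁ (𝟙-prob (φ x)))) ,
  subst (Σ[ xs ] (λ x → w x · 𝟙 (φ x)) ≤_) Σw≡1 (Σ-mono-≤ xs λ x →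
    subst (w x · 𝟙 (φ x) ≤_) (*-identityʳ (w x))
      (*-monoˡ-≤-nonNeg (w x) {{nonNegative (0≤w x)}} (proj₂ (𝟙-prob (φ x)))))

Σ-bit-split : {A : Set} (xs : List A) (w : A → ℚ) → Σ[ xs ] w ≡ 1ℚ → (φ : A → Bool) (g : Bool → ℚ) →
              let P = Σ[ xs ] (λ x → w x · 𝟙 (φ x)) in
              Σ[ xs ] (λ x → w x · g (φ x)) ≡ (1ℚ - P) · g false + P · g true
Σ-bit-split xs w Σw≡1 φ g = begin
  Σ[ xs ] (λ x → w x · g (φ x))
    ≡⟨ Σ-cong xs (λ x → split (w x) (φ x)) ⟩
  Σ[ xs ] (λ x → w x · g false + w x · 𝟙 (φ x) · d)
    ≡⟨ Σ-distrib-+ xs _ _ ⟩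
  Σ[ xs ] (λ x → w x · g false) + Σ[ xs ] (λ x → w x · 𝟙 (φ x) · d)
    ≡⟨ cong₂ _+_ (trans (Σ-*ʳ xs (g false) w) (cong (_· g false) Σw≡1)) (Σ-*ʳ xs d _) ⟩
  1ℚ · g false + P · d
    ≡⟨ solve 3 (λ P f t → con 1ℚ :* f :+ P :* (t :- f) := (con 1ℚ :- P) :* f :+ P :* t) refl P (g false) (g true) ⟩
  (1ℚ - P) · g false + P · g true ∎
  where
  open ≡-Reasoning
  P = Σ[ xs ] (λ x → w x · 𝟙 (φ x))
  d = g true - g false
  split : (a : ℚ) (b : Bool) → a · g b ≡ a · g false + a · 𝟙 b · d
  split a false = solve 3 (λ a f t → a :* f := a :* f :+ a :* con 0ℚ :* (t :- f)) refl a (g false) (g true)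
  split a true  = solve 3 (λ a f t → a :* t := a :* f :+ a :* con 1ℚ :* (t :- f)) refl a (g false) (g true)

-- The uniform distribution and its images

bits : List Bool
bits = false ∷ true ∷ []

Σ-½^n : (n : ℕ) → Σ[ allPoints n ] (λ _ → ½ ^ℚ n) ≡ 1ℚ
Σ-½^n zero    = refl
Σ-½^n (suc n) = trans (Σ-allVecs bits n _)
  (cong (λ t → t + (t + 0ℚ)) (trans (Σ-*ˡ (allPoints n) ½ _) (cong (½ ·_) (Σ-½^n n))))

PrUniform-const : (n : ℕ) (b : Bool) → PrUniform n (λ _ → b) ≡ 𝟙 b
PrUniform-const n b =
  trans (Σ-*ˡ (allPoints n) (𝟙 b) _) (trans (cong (𝟙 b ·_) (Σ-½^n n)) (*-identityʳ (𝟙 b)))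

PrUniform-suc : (n : ℕ) (T : Subset (suc n)) →
                PrUniform (suc n) T ≡ ½ · PrUniform n (λ y → T (false ∷ y)) + ½ · PrUniform n (λ y → T (true ∷ y))
PrUniform-suc n T = begin
  PrUniform (suc n) T
    ≡⟨ Σ-allVecs bits n _ ⟩
  Σ[ bits ] (λ b → Σ[ allPoints n ] (λ y → 𝟙 (T (b ∷ y)) · (½ · ½ ^ℚ n)))
    ≡⟨ cong₂ (λ u v → u + (v + 0ℚ)) (branch false) (branch true) ⟩
  ½ · P false + (½ · P true + 0ℚ)
    ≡⟨ cong (_+_ (½ · P false)) (+-identityʳ (½ · P true)) ⟩
  ½ · P false + ½ · P true ∎
  where
  open ≡-Reasoning
  P : Bool → ℚ
  P b = PrUniform n (λ y → T (b ∷ y))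
  branch : (b : Bool) → Σ[ allPoints n ] (λ y → 𝟙 (T (b ∷ y)) · (½ · ½ ^ℚ n)) ≡ ½ · P b
  branch b = trans (Σ-cong (allPoints n) (λ y → solve 3 (λ u h w → u :* (h :* w) := h :* (u :* w))
                                                      refl (𝟙 (T (b ∷ y))) ½ (½ ^ℚ n)))
                   (Σ-*ˡ (allPoints n) ½ (λ y → 𝟙 (T (b ∷ y)) · ½ ^ℚ n))

PrUniform-prob : (n : ℕ) (T : Subset n) → IsProb (PrUniform n T)
PrUniform-prob n T = subst IsProb (Σ-cong (allPoints n) (λ x → *-comm (½ ^ℚ n) (𝟙 (T x))))
  (Σ-𝟙-prob (allPoints n) (λ _ → ^-nonNeg n 0≤½) (Σ-½^n n) T)

PrUniform-fresh : (n : ℕ) (b : Bool) → ½ · PrUniform n (λ _ → b) + ½ · PrUniform n (λ _ → not b) ≡ ½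
PrUniform-fresh n b =
  trans (cong₂ (λ u v → ½ · u + ½ · v) (PrUniform-const n b) (PrUniform-const n (not b))) (halves b)
  where
  halves : (b : Bool) → ½ · 𝟙 b + ½ · 𝟙 (not b) ≡ ½
  halves false = refl
  halves true  = refl

unbiased⇒bias≤ : {x e : ℚ} → x ≡ ½ → 0ℚ ≤ e → ∣ x - ½ ∣ ≤ e
unbiased⇒bias≤ refl 0≤e = 0≤e

½-average-bias : {n : ℕ} {e : ℚ} (T : Subset (suc n)) → PrUniform n (λ y → T (false ∷ y)) ≡ ½ →
                 ∣ PrUniform n (λ y → T (true ∷ y)) - ½ ∣ ≤ e → ∣ PrUniform (suc n) T - ½ ∣ ≤ ½ · e
½-average-bias {n} {e} T unbiased biased = begin
  ∣ PrUniform (suc n) T - ½ ∣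
    ≡⟨ cong (λ x → ∣ x - ½ ∣) (trans (PrUniform-suc n T) (cong (λ x → ½ · x + ½ · Pₜ) unbiased)) ⟩
  ∣ ½ · ½ + ½ · Pₜ - ½ ∣
    ≡⟨ cong ∣_∣ (solve 1 (λ x → con ½ :* con ½ :+ con ½ :* x :- con ½ := con ½ :* (x :- con ½)) refl Pₜ) ⟩
  ∣ ½ · (Pₜ - ½) ∣
    ≤⟨ ∣c*p∣≤c*q 0≤½ biased ⟩
  ½ · e ∎
  where
  open ≤-Reasoning
  Pₜ = PrUniform n (λ y → T (true ∷ y))

_≟ᵖ_ : {n : ℕ} → DecidableEquality (Point n)
_≟ᵖ_ = ≡-dec Bool._≟_

imageLaw : {r q : ℕ} → (Point r → Point q) → Point q → ℚ
imageLaw {r} F x = PrUniform r (λ s → does (F s ≟ᵖ x))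

Σ-𝟙≟ : {k : ℕ} (v : Point k) (G : Point k → ℚ) →
       Σ[ allPoints k ] (λ x → 𝟙 (does (v ≟ᵖ x)) · G x) ≡ G v
Σ-𝟙≟ []               G = trans (+-identityʳ _) (*-identityˡ _)
Σ-𝟙≟ {suc k} (b ∷ v) G = begin
  Σ[ allPoints (suc k) ] (λ x → 𝟙 (does ((b ∷ v) ≟ᵖ x)) · G x)
    ≡⟨ Σ-allVecs bits k _ ⟩
  Σ[ bits ] (λ a → Σ[ allPoints k ] (λ x → 𝟙 (does (b Bool.≟ a) ∧ does (v ≟ᵖ x)) · G (a ∷ x)))
    ≡⟨ Σ-cong bits (λ a → trans (Σ-cong (allPoints k) (split a))
                         (trans (Σ-*ˡ (allPoints k) (δ a) (λ x → 𝟙 (does (v ≟ᵖ x)) · G (a ∷ x)))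
                                (cong (δ a ·_) (Σ-𝟙≟ v (λ x → G (a ∷ x)))))) ⟩
  Σ[ bits ] (λ a → δ a · G (a ∷ v))
    ≡⟨ pick b ⟩
  G (b ∷ v) ∎
  where
  open ≡-Reasoning
  δ : Bool → ℚ
  δ a = 𝟙 (does (b Bool.≟ a))
  split : (a : Bool) (x : Point k) →
          𝟙 (does (b Bool.≟ a) ∧ does (v ≟ᵖ x)) · G (a ∷ x) ≡ δ a · (𝟙 (does (v ≟ᵖ x)) · G (a ∷ x))
  split a x = trans (cong (_· G (a ∷ x)) (𝟙-∧ (does (b Bool.≟ a)) (does (v ≟ᵖ x))))
                    (*-assoc (δ a) (𝟙 (does (v ≟ᵖ x))) (G (a ∷ x)))
  pick : (e : Bool) → Σ[ bits ] (λ a → 𝟙 (does (e Bool.≟ a)) · G (a ∷ v)) ≡ G (e ∷ v)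
  pick false = solve 2 (λ u w → con 1ℚ :* u :+ (con 0ℚ :* w :+ con 0ℚ) := u) refl (G (false ∷ v)) (G (true ∷ v))
  pick true  = solve 2 (λ u w → con 0ℚ :* u :+ (con 1ℚ :* w :+ con 0ℚ) := w) refl (G (false ∷ v)) (G (true ∷ v))

Σ-imageLaw : {r q : ℕ} (F : Point r → Point q) (G : Point q → ℚ) →
             Σ[ allPoints q ] (λ x → imageLaw F x · G x) ≡ Σ[ allPoints r ] (λ s → G (F s) · ½ ^ℚ r)
Σ-imageLaw {r} {q} F G = begin
  Σ[ allPoints q ] (λ x → imageLaw F x · G x)
    ≡⟨ Σ-cong (allPoints q) (λ x → sym (Σ-*ʳ (allPoints r) (G x) (λ s → hit s x · w))) ⟩
  Σ[ allPoints q ] (λ x → Σ[ allPoints r ] (λ s → hit s x · w · G x))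
    ≡⟨ Σ-comm (allPoints q) (allPoints r) (λ x s → hit s x · w · G x) ⟩
  Σ[ allPoints r ] (λ s → Σ[ allPoints q ] (λ x → hit s x · w · G x))
    ≡⟨ Σ-cong (allPoints r) (λ s → trans (Σ-cong (allPoints q) (λ x → swap (hit s x) (G x)))
                                         (Σ-*ʳ (allPoints q) w (λ x → hit s x · G x))) ⟩
  Σ[ allPoints r ] (λ s → Σ[ allPoints q ] (λ x → hit s x · G x) · w)
    ≡⟨ Σ-cong (allPoints r) (λ s → cong (_· w) (Σ-𝟙≟ (F s) G)) ⟩
  Σ[ allPoints r ] (λ s → G (F s) · w) ∎
  where
  open ≡-Reasoning
  w = ½ ^ℚ r
  hit : Point r → Point q → ℚ
  hit s x = 𝟙 (does (F s ≟ᵖ x))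
  swap : (a g : ℚ) → a · w · g ≡ a · g · w
  swap a g = solve 3 (λ a w g → a :* w :* g := a :* g :* w) refl a w g

imageLaw-nonNeg : {r q : ℕ} (F : Point r → Point q) (x : Point q) → 0ℚ ≤ imageLaw F x
imageLaw-nonNeg {r} F x = proj₁ (PrUniform-prob r (λ s → does (F s ≟ᵖ x)))

imageLaw-total : {r q : ℕ} (F : Point r → Point q) → Σ[ allPoints q ] (imageLaw F) ≡ 1ℚ
imageLaw-total {r} {q} F = begin
  Σ[ allPoints q ] (imageLaw F)                   ≡⟨ Σ-cong (allPoints q) (λ x → sym (*-identityʳ _)) ⟩
  Σ[ allPoints q ] (λ x → imageLaw F x · 𝟙 true)  ≡⟨ Σ-imageLaw F (λ _ → 𝟙 true) ⟩
  PrUniform r (λ _ → true)                        ≡⟨ PrUniform-const r true ⟩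
  1ℚ                                              ∎
  where open ≡-Reasoning

imageLaw-support : {r q : ℕ} (F : Point r → Point q) (x : Point q) →
                   ¬ (imageLaw F x ≡ 0ℚ) → ∃ λ s → F s ≡ x
imageLaw-support {r} F x law≢0 with Σ-≢0⇒∃ (allPoints r) law≢0
... | s , term≢0 with F s ≟ᵖ x
...   | yes Fs≡x = s , Fs≡x
...   | no  _    = ⊥-elim (term≢0 (*-zeroˡ (½ ^ℚ r)))

-- Product distributions

column : {n q : ℕ} → Vec (Point n) q → Fin n → Point q
column s i = Vec.map (λ y → lookup y i) s

tails : {n q : ℕ} → Vec (Point (suc n)) q → Vec (Point n) q
tails = Vec.map Vec.tail

glue : {n q : ℕ} → Point q → Vec (Point n) q → Vec (Point (suc n)) q
glue = zipWith _∷_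

column-glue : {n q : ℕ} (x : Point q) (s : Vec (Point n) q) → column (glue x s) zero ≡ x
column-glue []      []      = refl
column-glue (b ∷ x) (y ∷ s) = cong (b ∷_) (column-glue x s)

tails-glue : {n q : ℕ} (x : Point q) (s : Vec (Point n) q) → tails (glue x s) ≡ s
tails-glue []      []      = refl
tails-glue (b ∷ x) (y ∷ s) = cong (y ∷_) (tails-glue x s)

column-suc : {n q : ℕ} (s : Vec (Point (suc n)) q) (i : Fin n) → column s (suc i) ≡ column (tails s) i
column-suc []            i = refl
column-suc ((b ∷ y) ∷ s) i = cong (lookup y i ∷_) (column-suc s i)

dot : {q : ℕ} → Vec ℤ q → Point q → ℤ
dot c x = sumℤ (zipWith (λ cⱼ b → cⱼ ℤ.* bitℤ b) c x)

lincomb≡dot-column : {n q : ℕ} (c : Vec ℤ q) (s : Vec (Point n) q) (i : Fin n) →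
                     lincomb c s i ≡ dot c (column s i)
lincomb≡dot-column c s i = cong sumℤ (sym (zipWith-map₂ (λ cⱼ b → cⱼ ℤ.* bitℤ b) (λ y → lookup y i) c s))

Σ-allSamples-suc : (n q : ℕ) (f : Vec (Point (suc n)) q → ℚ) →
                   Σ[ allSamples (suc n) q ] f ≡ Σ[ allPoints q ] (λ x → Σ[ allSamples n q ] (λ s → f (glue x s)))
Σ-allSamples-suc n zero    f = sym (+-identityʳ _)
Σ-allSamples-suc n (suc q) f = begin
  Σ[ allSamples (suc n) (suc q) ] f
    ≡⟨ Σ-allVecs (allPoints (suc n)) q f ⟩
  Σ[ allPoints (suc n) ] (λ y → Σ[ allSamples (suc n) q ] (λ s → f (y ∷ s)))
    ≡⟨ Σ-allVecs bits n _ ⟩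
  Σ[ bits ] (λ b → Σ[ allPoints n ] (λ y → Σ[ allSamples (suc n) q ] (λ s → f ((b ∷ y) ∷ s))))
    ≡⟨ Σ-cong bits (λ b → Σ-cong (allPoints n) (λ y → Σ-allSamples-suc n q (λ s → f ((b ∷ y) ∷ s)))) ⟩
  Σ[ bits ] (λ b → Σ[ allPoints n ] (λ y → Σ[ allPoints q ] (g b y)))
    ≡⟨ Σ-cong bits (λ b → Σ-comm (allPoints n) (allPoints q) (g b)) ⟩
  Σ[ bits ] (λ b → Σ[ allPoints q ] (λ x → Σ[ allPoints n ] (λ y → g b y x)))
    ≡⟨ Σ-cong bits (λ b → Σ-cong (allPoints q) (λ x → Σ-allVecs (allPoints n) q (λ s → f (glue (b ∷ x) s)))) ⟨
  Σ[ bits ] (λ b → Σ[ allPoints q ] (λ x → Σ[ allSamples n (suc q) ] (λ s → f (glue (b ∷ x) s))))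
    ≡⟨ Σ-allVecs bits q _ ⟨
  Σ[ allPoints (suc q) ] (λ x → Σ[ allSamples n (suc q) ] (λ s → f (glue x s))) ∎
  where
  open ≡-Reasoning
  g : Bool → Point n → Point q → ℚ
  g b y x = Σ[ allSamples n q ] (λ s → f ((b ∷ y) ∷ glue x s))

PrMarginal-prob : {n q : ℕ} (D : Distribution n q) (j : Fin q) (T : Subset n) → IsProb (PrMarginal D j T)
PrMarginal-prob {n} {q} D j T = Σ-𝟙-prob (allSamples n q) (nonneg D) (total D) (λ s → T (lookup s j))

hybrid-step : {a x y u ε δ : ℚ} → IsProb a → ∣ x ∣ ≤ ε → ∣ y ∣ ≤ ε → ∣ a - ½ ∣ ≤ δ → ∣ u ∣ ≤ 1ℚ →
              ∣ (1ℚ - a) · x + a · y + (a - ½) · u ∣ ≤ ε + δ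
hybrid-step {a} {x} {y} {u} {ε} {δ} (0≤a , a≤1) ∣x∣≤ε ∣y∣≤ε ∣a-½∣≤δ ∣u∣≤1 = begin
  ∣ (1ℚ - a) · x + a · y + (a - ½) · u ∣
    ≤⟨ ∣p+q∣≤∣p∣+∣q∣ ((1ℚ - a) · x + a · y) ((a - ½) · u) ⟩
  ∣ (1ℚ - a) · x + a · y ∣ + ∣ (a - ½) · u ∣
    ≤⟨ +-mono-≤ (≤-trans (∣p+q∣≤∣p∣+∣q∣ ((1ℚ - a) · x) (a · y))
                         (+-mono-≤ (∣c*p∣≤c*q (0≤1-p a≤1) ∣x∣≤ε) (∣c*p∣≤c*q 0≤a ∣y∣≤ε)))
                ∣[a-½]u∣≤δ ⟩
  (1ℚ - a) · ε + a · ε + δ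
    ≡⟨ solve 3 (λ a ε δ → (con 1ℚ :- a) :* ε :+ a :* ε :+ δ := ε :+ δ) refl a ε δ ⟩
  ε + δ ∎
  where
  open ≤-Reasoning
  ∣[a-½]u∣≤δ : ∣ (a - ½) · u ∣ ≤ δ
  ∣[a-½]u∣≤δ = begin
    ∣ (a - ½) · u ∣      ≡⟨ ∣p*q∣≡∣p∣*∣q∣ (a - ½) u ⟩
    ∣ a - ½ ∣ · ∣ u ∣    ≤⟨ *-mono-≤-nonNeg (0≤∣p∣ (a - ½)) ∣a-½∣≤δ (0≤∣p∣ u) ∣u∣≤1 ⟩
    δ · 1ℚ               ≡⟨ *-identityʳ δ ⟩
    δ                    ∎

module Product {q : ℕ} (p : Point q → ℚ) (p-nonNeg : ∀ x → 0ℚ ≤ p x) (p-total : Σ[ allPoints q ] p ≡ 1ℚ)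
  where

  prod : (n : ℕ) → Vec (Point n) q → ℚ
  prod zero    s = 1ℚ
  prod (suc n) s = p (column s zero) · prod n (tails s)

  prod-glue : (n : ℕ) (x : Point q) (s : Vec (Point n) q) → prod (suc n) (glue x s) ≡ p x · prod n s
  prod-glue n x s = cong₂ (λ x s → p x · prod n s) (column-glue x s) (tails-glue x s)

  prod-nonNeg : (n : ℕ) (s : Vec (Point n) q) → 0ℚ ≤ prod n s
  prod-nonNeg zero    s = 0≤1
  prod-nonNeg (suc n) s = *-nonNeg (p-nonNeg (column s zero)) (prod-nonNeg n (tails s))

  prod-total : (n : ℕ) → Σ[ allSamples n q ] (prod n) ≡ 1ℚ
  prod-total zero = single-sample q
    where
    single-sample : (r : ℕ) → Σ[ allSamples 0 r ] (λ _ → 1ℚ) ≡ 1ℚ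
    single-sample zero    = refl
    single-sample (suc r) = trans (Σ-allVecs (allPoints 0) r _) (cong (_+ 0ℚ) (single-sample r))
  prod-total (suc n) = begin
    Σ[ allSamples (suc n) q ] (prod (suc n))
      ≡⟨ Σ-allSamples-suc n q (prod (suc n)) ⟩
    Σ[ allPoints q ] (λ x → Σ[ allSamples n q ] (λ s → prod (suc n) (glue x s)))
      ≡⟨ Σ-cong (allPoints q) (λ x → trans (Σ-cong (allSamples n q) (prod-glue n x))
                                           (Σ-*ˡ (allSamples n q) (p x) (prod n))) ⟩
    Σ[ allPoints q ] (λ x → p x · Σ[ allSamples n q ] (prod n))
      ≡⟨ Σ-cong (allPoints q) (λ x → trans (cong (p x ·_) (prod-total n)) (*-identityʳ (p x))) ⟩
    Σ[ allPoints q ] p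
      ≡⟨ p-total ⟩
    1ℚ ∎
    where open ≡-Reasoning

  product : (n : ℕ) → Distribution n q
  product n = record { pr = prod n ; nonneg = prod-nonNeg n ; total = prod-total n }

  support-columns : (n : ℕ) (s : Vec (Point n) q) → InSupport (product n) s →
                    (i : Fin n) → ¬ (p (column s i) ≡ 0ℚ)
  support-columns (suc n) s s∈D zero    = proj₁ (*≢0⇒≢0 {q = prod n (tails s)} s∈D)
  support-columns (suc n) s s∈D (suc i) rewrite column-suc s i =
    support-columns n (tails s) (proj₂ (*≢0⇒≢0 {p (column s zero)} s∈D)) i

  bitMean : Fin q → ℚ
  bitMean j = Σ[ allPoints q ] (λ x → p x · 𝟙 (lookup x j))

  marginal-zero : (j : Fin q) (T : Subset 0) → PrMarginal (product 0) j T ≡ PrUniform 0 T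
  marginal-zero j T = begin
    Σ[ allSamples 0 q ] (λ s → prod 0 s · 𝟙 (T (lookup s j)))
      ≡⟨ Σ-cong (allSamples 0 q) (λ s → cong (λ y → prod 0 s · 𝟙 (T y)) (point₀ (lookup s j))) ⟩
    Σ[ allSamples 0 q ] (λ s → prod 0 s · 𝟙 (T []))
      ≡⟨ trans (Σ-*ʳ (allSamples 0 q) (𝟙 (T [])) (prod 0)) (cong (_· 𝟙 (T [])) (prod-total 0)) ⟩
    1ℚ · 𝟙 (T [])
      ≡⟨ solve 1 (λ t → con 1ℚ :* t := t :* con 1ℚ :+ con 0ℚ) refl (𝟙 (T [])) ⟩
    PrUniform 0 T ∎
    where
    open ≡-Reasoning
    point₀ : (y : Point 0) → y ≡ []
    point₀ [] = refl

  marginal-suc : (n : ℕ) (j : Fin q) (T : Subset (suc n)) →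
                 PrMarginal (product (suc n)) j T
                   ≡ (1ℚ - bitMean j) · PrMarginal (product n) j (λ y → T (false ∷ y))
                     + bitMean j · PrMarginal (product n) j (λ y → T (true ∷ y))
  marginal-suc n j T = begin
    Σ[ allSamples (suc n) q ] (λ s → prod (suc n) s · 𝟙 (T (lookup s j)))
      ≡⟨ Σ-allSamples-suc n q _ ⟩
    Σ[ allPoints q ] (λ x → Σ[ allSamples n q ] (λ s → prod (suc n) (glue x s) · 𝟙 (T (lookup (glue x s) j))))
      ≡⟨ Σ-cong (allPoints q) (λ x → trans (Σ-cong (allSamples n q) (factor x)) (Σ-*ˡ (allSamples n q) (p x) _)) ⟩
    Σ[ allPoints q ] (λ x → p x · PrMarginal (product n) j (λ y → T (lookup x j ∷ y)))
      ≡⟨ Σ-bit-split (allPoints q) p p-total (λ x → lookup x j)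
                     (λ b → PrMarginal (product n) j (λ y → T (b ∷ y))) ⟩
    (1ℚ - bitMean j) · PrMarginal (product n) j (λ y → T (false ∷ y))
      + bitMean j · PrMarginal (product n) j (λ y → T (true ∷ y)) ∎
    where
    open ≡-Reasoning
    factor : (x : Point q) (s : Vec (Point n) q) →
             prod (suc n) (glue x s) · 𝟙 (T (lookup (glue x s) j))
               ≡ p x · (prod n s · 𝟙 (T (lookup x j ∷ lookup s j)))
    factor x s = trans (cong₂ (λ u y → u · 𝟙 (T y)) (prod-glue n x s) (lookup-zipWith _∷_ j x s))
                       (*-assoc (p x) (prod n s) _)

  marginal-distance : {j : Fin q} {δ : ℚ} → ∣ bitMean j - ½ ∣ ≤ δ → (n : ℕ) (T : Subset n) →
                      ∣ PrMarginal (product n) j T - PrUniform n T ∣ ≤ (+ n / 1) · δ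
  marginal-distance {j} {δ} bias zero T = ≤-reflexive (begin-equality
    ∣ PrMarginal (product 0) j T - PrUniform 0 T ∣  ≡⟨ cong (λ m → ∣ m - PrUniform 0 T ∣) (marginal-zero j T) ⟩
    ∣ PrUniform 0 T - PrUniform 0 T ∣               ≡⟨ cong ∣_∣ (+-inverseʳ (PrUniform 0 T)) ⟩
    0ℚ                                              ≡⟨ *-zeroˡ δ ⟨
    (+ 0 / 1) · δ                                   ∎)
    where open ≤-Reasoning
  marginal-distance {j} {δ} bias (suc n) T = begin
    ∣ PrMarginal (product (suc n)) j T - PrUniform (suc n) T ∣
      ≡⟨ cong ∣_∣ (cong₂ _-_ (marginal-suc n j T) (PrUniform-suc n T)) ⟩
    ∣ (1ℚ - a) · Mf + a · Mt - (½ · Uf + ½ · Ut) ∣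
      ≡⟨ cong ∣_∣ (solve 5 (λ a Mf Mt Uf Ut →
           (con 1ℚ :- a) :* Mf :+ a :* Mt :- (con ½ :* Uf :+ con ½ :* Ut)
           := (con 1ℚ :- a) :* (Mf :- Uf) :+ a :* (Mt :- Ut) :+ (a :- con ½) :* (Ut :- Uf)) refl a Mf Mt Uf Ut) ⟩
    -- the errors of the last n coordinates, plus that of replacing the first bit (mean a) by a fair one
    ∣ (1ℚ - a) · (Mf - Uf) + a · (Mt - Ut) + (a - ½) · (Ut - Uf) ∣
      ≤⟨ hybrid-step (Σ-𝟙-prob (allPoints q) p-nonNeg p-total (λ x → lookup x j))
                     (marginal-distance bias n Tf) (marginal-distance bias n Tt) bias
                     (∣p-q∣≤1 (PrUniform-prob n Tt) (PrUniform-prob n Tf)) ⟩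
    (+ n / 1) · δ + δ
      ≡⟨ solve 2 (λ k δ → k :* δ :+ δ := (con 1ℚ :+ k) :* δ) refl (+ n / 1) δ ⟩
    (1ℚ + + n / 1) · δ
      ≡⟨ cong (_· δ) (+[1+n]/1≡1+n/1 n) ⟨
    (+ suc n / 1) · δ ∎
    where
    open ≤-Reasoning
    a = bitMean j
    Tf Tt : Subset n
    Tf y = T (false ∷ y)
    Tt y = T (true ∷ y)
    Mf = PrMarginal (product n) j Tf
    Mt = PrMarginal (product n) j Tt
    Uf = PrUniform n Tf
    Ut = PrUniform n Tt

-- The carry chain

double : ℕ → ℕ
double zero    = zero
double (suc k) = suc (suc (double k))

double≡2* : (k : ℕ) → double k ≡ 2 * k
double≡2* zero    = refl
double≡2* (suc k) =
  trans (cong (λ i → suc (suc i)) (double≡2* k)) (cong suc (sym (ℕ.+-suc k (k ℕ.+ 0))))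

carryPairs : (k : ℕ) → Bool → Point (suc k) → Point (double (suc k))
carryPairs zero    g (a ∷ []) = (a ∧ not g) ∷ (a ∨ g) ∷ []
carryPairs (suc k) g (a ∷ s)  = a ∷ (a xor g) ∷ carryPairs k (a ∧ g) s

carryWeights : (k : ℕ) → ℤ → Vec ℤ (double (suc k))
carryWeights zero    w = ℤ.- w ∷ w ∷ []
carryWeights (suc k) w = ℤ.- w ∷ w ∷ carryWeights k (w ℤ.+ w)

gadget : (m : ℕ) → Point (suc m) → Point (suc (double m))
gadget zero    _       = true ∷ []
gadget (suc m) (e ∷ s) = not e ∷ carryPairs m e s

gadgetCoeffs : (m : ℕ) → Vec ℤ (suc (double m))
gadgetCoeffs zero    = + 1 ∷ []
gadgetCoeffs (suc m) = + 1 ∷ carryWeights m (+ 1)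

sumℤ-carryWeights : (k : ℕ) (w : ℤ) → sumℤ (carryWeights k w) ≡ + 0
sumℤ-carryWeights zero    w = trans (cong (ℤ._+_ (ℤ.- w)) (ℤ.+-identityʳ w)) (ℤ.+-inverseˡ w)
sumℤ-carryWeights (suc k) w =
  trans (cong (λ t → ℤ.- w ℤ.+ (w ℤ.+ t)) (sumℤ-carryWeights k (w ℤ.+ w))) (sumℤ-carryWeights zero w)

sumℤ-gadgetCoeffs : (m : ℕ) → sumℤ (gadgetCoeffs m) ≡ + 1
sumℤ-gadgetCoeffs zero    = refl
sumℤ-gadgetCoeffs (suc m) = cong (ℤ._+_ (+ 1)) (sumℤ-carryWeights m (+ 1))

dot-carryPairs : (k : ℕ) (w : ℤ) (g : Bool) (s : Point (suc k)) →
                 dot (carryWeights k w) (carryPairs k g s) ≡ w ℤ.* bitℤ g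
dot-carryPairs zero w g (a ∷ []) = begin
  ℤ.- w ℤ.* bitℤ (a ∧ not g) ℤ.+ (w ℤ.* bitℤ (a ∨ g) ℤ.+ + 0)
    ≡⟨ ZS.solve 3 (λ w A B → ZS.:- w ZS.:* A ZS.:+ (w ZS.:* B ZS.:+ ZS.con (+ 0)) ZS.:= w ZS.:* (B ZS.:- A))
         refl w (bitℤ (a ∧ not g)) (bitℤ (a ∨ g)) ⟩
  w ℤ.* (bitℤ (a ∨ g) ℤ.- bitℤ (a ∧ not g))
    ≡⟨ cong (w ℤ.*_) (last-pair a g) ⟩
  w ℤ.* bitℤ g ∎
  where
  open ≡-Reasoning
  last-pair : (a g : Bool) → bitℤ (a ∨ g) ℤ.- bitℤ (a ∧ not g) ≡ bitℤ g
  last-pair false false = refl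
  last-pair false true  = refl
  last-pair true  false = refl
  last-pair true  true  = refl
dot-carryPairs (suc k) w g (a ∷ s) = begin
  ℤ.- w ℤ.* bitℤ a ℤ.+ (w ℤ.* bitℤ (a xor g) ℤ.+ dot (carryWeights k (w ℤ.+ w)) (carryPairs k (a ∧ g) s))
    ≡⟨ cong (λ t → ℤ.- w ℤ.* bitℤ a ℤ.+ (w ℤ.* bitℤ (a xor g) ℤ.+ t)) (dot-carryPairs k (w ℤ.+ w) (a ∧ g) s) ⟩
  ℤ.- w ℤ.* bitℤ a ℤ.+ (w ℤ.* bitℤ (a xor g) ℤ.+ (w ℤ.+ w) ℤ.* bitℤ (a ∧ g))
    ≡⟨ ZS.solve 4 (λ w A X C → ZS.:- w ZS.:* A ZS.:+ (w ZS.:* X ZS.:+ (w ZS.:+ w) ZS.:* C)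
                               ZS.:= w ZS.:* (X ZS.:- A ZS.:+ (C ZS.:+ C)))
         refl w (bitℤ a) (bitℤ (a xor g)) (bitℤ (a ∧ g)) ⟩
  w ℤ.* (bitℤ (a xor g) ℤ.- bitℤ a ℤ.+ (bitℤ (a ∧ g) ℤ.+ bitℤ (a ∧ g)))
    ≡⟨ cong (w ℤ.*_) (carry-pair a g) ⟩
  w ℤ.* bitℤ g ∎
  where
  open ≡-Reasoning
  carry-pair : (a g : Bool) → bitℤ (a xor g) ℤ.- bitℤ a ℤ.+ (bitℤ (a ∧ g) ℤ.+ bitℤ (a ∧ g)) ≡ bitℤ g
  carry-pair false false = refl
  carry-pair false true  = refl
  carry-pair true  false = refl
  carry-pair true  true  = refl

dot-gadget : (m : ℕ) (s : Point (suc m)) → dot (gadgetCoeffs m) (gadget m s) ≡ + 1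
dot-gadget zero    _       = refl
dot-gadget (suc m) (e ∷ s) =
  trans (cong (ℤ._+_ (+ 1 ℤ.* bitℤ (not e))) (dot-carryPairs m (+ 1) e s)) (complementary e)
  where
  complementary : (e : Bool) → + 1 ℤ.* bitℤ (not e) ℤ.+ + 1 ℤ.* bitℤ e ≡ + 1
  complementary false = refl
  complementary true  = refl

bitOf : {r q : ℕ} → (Point r → Point q) → Fin q → Subset r
bitOf F j s = lookup (F s) j

carryPairs-unbiased : (k : ℕ) (j : Fin (double (suc k))) →
                      PrUniform (suc k) (bitOf (carryPairs k false) j) ≡ ½
carryPairs-unbiased zero    zero          = refl
carryPairs-unbiased zero    (suc zero)    = refl
carryPairs-unbiased (suc k) zero          =
  trans (PrUniform-suc (suc k) (bitOf (carryPairs (suc k) false) zero)) (PrUniform-fresh (suc k) false)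
carryPairs-unbiased (suc k) (suc zero)    =
  trans (PrUniform-suc (suc k) (bitOf (carryPairs (suc k) false) (suc zero))) (PrUniform-fresh (suc k) false)
carryPairs-unbiased (suc k) (suc (suc j)) =
  trans (PrUniform-suc (suc k) (bitOf (carryPairs (suc k) false) (suc (suc j))))
        (cong₂ (λ u v → ½ · u + ½ · v) (carryPairs-unbiased k j) (carryPairs-unbiased k j))

carryPairs-biased : (k : ℕ) (j : Fin (double (suc k))) →
                    ∣ PrUniform (suc k) (bitOf (carryPairs k true) j) - ½ ∣ ≤ ½ ^ℚ suc k
carryPairs-biased zero    zero          = ≤-refl
carryPairs-biased zero    (suc zero)    = ≤-refl
carryPairs-biased (suc k) zero          = unbiased⇒bias≤
  (trans (PrUniform-suc (suc k) (bitOf (carryPairs (suc k) true) zero)) (PrUniform-fresh (suc k) false))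
  (^-nonNeg (suc (suc k)) 0≤½)
carryPairs-biased (suc k) (suc zero)    = unbiased⇒bias≤
  (trans (PrUniform-suc (suc k) (bitOf (carryPairs (suc k) true) (suc zero))) (PrUniform-fresh (suc k) true))
  (^-nonNeg (suc (suc k)) 0≤½)
carryPairs-biased (suc k) (suc (suc j)) =
  ½-average-bias (bitOf (carryPairs (suc k) true) (suc (suc j))) (carryPairs-unbiased k j) (carryPairs-biased k j)

gadget-bias : (m : ℕ) (j : Fin (suc (double m))) →
              ∣ PrUniform (suc m) (bitOf (gadget m) j) - ½ ∣ ≤ ½ ^ℚ suc m
gadget-bias zero    zero    = ≤-refl
gadget-bias (suc m) zero    = unbiased⇒bias≤
  (trans (PrUniform-suc (suc m) (bitOf (gadget (suc m)) zero)) (PrUniform-fresh (suc m) true))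
  (^-nonNeg (suc (suc m)) 0≤½)
gadget-bias (suc m) (suc j) =
  ½-average-bias (bitOf (gadget (suc m)) (suc j)) (carryPairs-unbiased m j) (carryPairs-biased m j)

½^[1+m]^4≤¼^[1+2m] : (m : ℕ) → (½ ^ℚ suc m) ^ℚ 4 ≤ ¼ ^ℚ suc (double m)
½^[1+m]^4≤¼^[1+2m] m = begin
  (½ ^ℚ suc m) ^ℚ 4          ≡⟨ exact m ⟩
  ¼ · ¼ ^ℚ suc (double m)    ≤⟨ *-monoʳ-≤-nonNeg (¼ ^ℚ suc (double m))
                                  {{nonNegative (^-nonNeg (suc (double m)) (from-yes (0ℚ ≤? ¼)))}}
                                  (from-yes (¼ ≤? 1ℚ)) ⟩
  1ℚ · ¼ ^ℚ suc (double m)   ≡⟨ *-identityˡ _ ⟩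
  ¼ ^ℚ suc (double m)        ∎
  where
  open ≤-Reasoning
  exact : (m : ℕ) → (½ ^ℚ suc m) ^ℚ 4 ≡ ¼ · ¼ ^ℚ suc (double m)
  exact zero    = refl
  exact (suc m) = begin-equality
    (½ · ½ ^ℚ suc m) ^ℚ 4             ≡⟨ ^-distribʳ-* ½ (½ ^ℚ suc m) 4 ⟩
    ½ ^ℚ 4 · (½ ^ℚ suc m) ^ℚ 4        ≡⟨ cong (½ ^ℚ 4 ·_) (exact m) ⟩
    ½ ^ℚ 4 · (¼ · Q)                  ≡⟨ solve 1 (λ Q → con (½ ^ℚ 4) :* (con ¼ :* Q) := con ¼ :* (con ¼ :* (con ¼ :* Q)))
                                                 refl Q ⟩
    ¼ · ¼ ^ℚ suc (double (suc m))     ∎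
    where Q = ¼ ^ℚ suc (double m)

gadget-support-solves : (m : ℕ) (x : Point (suc (double m))) → ¬ (imageLaw (gadget m) x ≡ 0ℚ) →
                        dot (gadgetCoeffs m) x ≡ + 1
gadget-support-solves m x x∈supp with imageLaw-support (gadget m) x x∈supp
... | seed , refl = dot-gadget m seed

NearUniformSolutions : (k q n : ℕ) → Set
NearUniformSolutions k q n =
  Σ (Vec ℤ q) λ c → Σ (Distribution n q) λ D →
    (∀ (s : Vec (Point n) q) → InSupport D s → (sumℤ c ≡ + 1) × (∀ (i : Fin n) → lincomb c s i ≡ + 1))
    × (∀ (j : Fin q) → MarginalClose k D j)

gadget-solutions : (m n : ℕ) → NearUniformSolutions 4 (suc (double m)) n
gadget-solutions m n =
  gadgetCoeffs m , product n , (λ s s∈D → sumℤ-gadgetCoeffs m , solves s s∈D) , close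
  where
  open Product (imageLaw (gadget m)) (imageLaw-nonNeg (gadget m)) (imageLaw-total (gadget m))

  solves : (s : Vec (Point n) (suc (double m))) → InSupport (product n) s →
           (i : Fin n) → lincomb (gadgetCoeffs m) s i ≡ + 1
  solves s s∈D i = trans (lincomb≡dot-column (gadgetCoeffs m) s i)
                         (gadget-support-solves m (column s i) (support-columns n s s∈D i))

  close : ∀ j → MarginalClose 4 (product n) j
  close j T = begin
    ∣ PrMarginal (product n) j T - PrUniform n T ∣ ^ℚ (2 * 4)
      ≤⟨ prob-^-squeeze 4 (0≤∣p∣ _ , ∣p-q∣≤1 (PrMarginal-prob (product n) j T) (PrUniform-prob n T))
                          (marginal-distance bias n T) ⟩
    (+ n / 1 · ½ ^ℚ suc m) ^ℚ 4
      ≡⟨ ^-distribʳ-* (+ n / 1) (½ ^ℚ suc m) 4 ⟩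
    (+ n / 1) ^ℚ 4 · (½ ^ℚ suc m) ^ℚ 4
      ≤⟨ *-monoˡ-≤-nonNeg ((+ n / 1) ^ℚ 4) {{nonNegative (^-nonNeg 4 (0≤n/1 n))}}
                          (½^[1+m]^4≤¼^[1+2m] m) ⟩
    (+ n / 1) ^ℚ 4 · ¼ ^ℚ suc (double m) ∎
    where
    open ≤-Reasoning
    bias : ∣ bitMean j - ½ ∣ ≤ ½ ^ℚ suc m
    bias = subst (λ x → ∣ x - ½ ∣ ≤ ½ ^ℚ suc m) (sym (Σ-imageLaw (gadget m) (λ x → 𝟙 (lookup x j))))
                 (gadget-bias m j)

lemma3p5 : Σ ℕ λ k → k ≥ 1 ×
             ((q : ℕ) → (∃ λ m → q ≡ suc (2 * m)) → (n : ℕ) →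
               Σ (Vec ℤ q) λ c → Σ (Distribution n q) λ D →
                 (∀ (s : Vec (Point n) q) → InSupport D s →
                   (sumℤ c ≡ + 1)
                   × (∀ (i : Fin n) → lincomb c s i ≡ + 1))
                 × (∀ (j : Fin q) → MarginalClose k D j))
lemma3p5 = 4 , s≤s z≤n , λ where
  q (m , refl) n →
    subst (λ q → NearUniformSolutions 4 q n) (cong suc (double≡2* m)) (gadget-solutions m n)
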